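{- Let $G$ be a connected graph and let $x$ be an extreme of $G$. Let $C$ be a component of $G-N[x]$ of maximum cardinality (so $G-N[x]$ is assumed nonempty), let $S=N(C)$ be the set of vertices of $V(G)\setminus C$ having a neighbor in $C$, and let $X=V(G)\setminus(N(C)\cup C)$. Then $x\in X$ and every vertex of $X$ is adjacent to every vertex of $S$.
   Context: For a vertex $v$ of a connected graph $G$, let $m(v)$ be the maximum cardinality of a component of $G-N[v]$ ($0$ if $G-N[v]$ is empty), where $N[v]$ is the closed neighborhood. A vertex $x$ is an extreme of $G$ if $m(x)=\max_{v\in V(G)} m(v)$. -}

module Defs where

open import Data.Nat using (ℕ; zero; _≤_)
open import Data.Fin using (Fin)
open import Data.Fin.Subset using (Subset; _∈_; _∉_; ∣_∣)
open import Data.Product using (Σ; _×_; ∃-syntax)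
open import Data.Sum using (_⊎_)
open import Data.Unit using (⊤)
open import Relation.Nullary using (¬_; Dec)
open import Relation.Binary.PropositionalEquality using (_≡_)

record Graph (n : ℕ) : Set₁ where
  field
    _~_   : Fin n → Fin n → Set
    dec   : ∀ u v → Dec (u ~ v)
    sym   : ∀ {u v} → u ~ v → v ~ u
    irrefl : ∀ {u} → ¬ (u ~ u)

module _ {n : ℕ} (G : Graph n) where
  open Graph G

  -- Reach P u v : there is a walk from u to v all of whose vertices satisfy P
  -- (i.e. u and v are connected in the subgraph induced by P).
  data Reach (P : Fin n → Set) : Fin n → Fin n → Set where
    here : ∀ {u} → P u → Reach P u u
    step : ∀ {u v w} → P u → u ~ v → Reach P v w → Reach P u w

  Connected : Set
  Connected = ∀ u v → Reach (λ _ → ⊤) u v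

  InClosedNbhd : Fin n → Fin n → Set
  InClosedNbhd v u = (u ≡ v) ⊎ (v ~ u)

  OutsideClosedNbhd : Fin n → Fin n → Set
  OutsideClosedNbhd v u = ¬ InClosedNbhd v u

  IsComponent : (Fin n → Set) → Subset n → Set
  IsComponent P C =
    (∃[ c ] c ∈ C) ×
    (∀ u → u ∈ C → P u) ×
    (∀ u v → u ∈ C → v ∈ C → Reach P u v) ×
    (∀ u v → u ∈ C → Reach P u v → v ∈ C)

  IsCompOf : Fin n → Subset n → Set
  IsCompOf v C = IsComponent (OutsideClosedNbhd v) C

  -- HasM v k  ⇔  k = m(v): the maximum cardinality of a component of G - N[v],
  -- with k = 0 when G - N[v] is empty (then there are no components).
  HasM : Fin n → ℕ → Set
  HasM v k =
    (∀ C → IsCompOf v C → ∣ C ∣ ≤ k) ×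
    ((k ≡ zero × (∀ u → ¬ OutsideClosedNbhd v u)) ⊎ (∃[ C ] (IsCompOf v C × ∣ C ∣ ≡ k)))

  IsExtreme : Fin n → Set
  IsExtreme x = ∃[ k ] (HasM x k × (∀ v k′ → HasM v k′ → k′ ≤ k))

  InNbhdOfSet : Subset n → Fin n → Set
  InNbhdOfSet C v = v ∉ C × (∃[ c ] (c ∈ C × v ~ c))

  InRest : Subset n → Fin n → Set
  InRest C v = v ∉ C × ¬ InNbhdOfSet C v

module Submission where

-- That x ∈ X is immediate, since
-- C avoids N[x].  For the adjacency claim take u ∈ X and v ∈ S with u ≁ v.
-- As u lies outside C and has no neighbour in C, all of C avoids N[u]; so
-- does v, and v has a neighbour in C.  Hence C ∪ {v} lies inside a single
-- component of G - N[u], giving m(u) > |C| ≥ k, against extremality of x.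
--
-- The one non-constructive point is that m(u) exists: forming the
-- components of G - N[u] needs reachability in G - N[u] to be decidable.
-- Adjacency is decidable, so it suffices to refute u ≁ v, and inside a
-- refutation the finitely many reachability questions may be assumed decided
-- (double negation commutes with finite products).

open import Defs
open import Data.Nat using (ℕ; zero; suc; _≤_; _<_; z≤n)
open import Data.Nat.Properties using (≤-trans; <⇒≱)
open import Data.Fin using (Fin; zero; suc)
open import Data.Fin.Properties using (_≟_; any?)
open import Data.Fin.Subset using (Subset; ∣_∣; _∈_)
open import Data.Fin.Subset.Properties using (⊆-antisym; p⊂q⇒∣p∣<∣q∣)
open import Data.Product using (_×_; _,_; proj₂; ∃-syntax)
open import Data.Sum using (_⊎_; inj₁; inj₂)
open import Data.Bool using (true)
open import Data.Empty using (⊥-elim)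
open import Data.List using (filter; allFin)
open import Data.List.Extrema.Nat using (argmax; argmax-all; f[xs]≤f[argmax])
open import Data.List.Relation.Unary.All using () renaming (lookup to All-lookup)
open import Data.List.Relation.Unary.All.Properties using (all-filter)
open import Data.List.Membership.Propositional.Properties using (∈-allFin; ∈-filter⁺)
open import Data.Vec using (tabulate)
open import Data.Vec.Properties using (lookup∘tabulate; lookup⇒[]=; []=⇒lookup)
open import Relation.Nullary using (¬_; Dec; yes; no; does; _⊎-dec_; ¬?)
open import Relation.Nullary.Decidable using (dec-true; decidable-stable; ¬¬-excluded-middle)
open import Relation.Binary.PropositionalEquality using (_≡_; refl; sym; trans; cong; subst)

¬¬-Π-Fin : ∀ {n} {B : Fin n → Set} → (∀ i → ¬ ¬ B i) → ¬ ¬ (∀ i → B i)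
¬¬-Π-Fin {zero}  h k = k (λ ())
¬¬-Π-Fin {suc n} h k =
  h zero λ b₀ → ¬¬-Π-Fin (λ i → h (suc i)) λ bs → k λ { zero → b₀ ; (suc i) → bs i }

¬¬-decidable₂ : ∀ {n} (R : Fin n → Fin n → Set) → ¬ ¬ (∀ a b → Dec (R a b))
¬¬-decidable₂ R = ¬¬-Π-Fin λ a → ¬¬-Π-Fin λ b → ¬¬-excluded-middle

subsetOf : ∀ {n} {Q : Fin n → Set} → (∀ i → Dec (Q i)) → Subset n
subsetOf Q? = tabulate (λ i → does (Q? i))

∈-subsetOf⁺ : ∀ {n} {Q : Fin n → Set} (Q? : ∀ i → Dec (Q i)) {i} → Q i → i ∈ subsetOf Q?
∈-subsetOf⁺ Q? {i} q = lookup⇒[]= i _ (trans (lookup∘tabulate _ i) (dec-true (Q? i) q))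

∈-subsetOf⁻ : ∀ {n} {Q : Fin n → Set} (Q? : ∀ i → Dec (Q i)) {i} → i ∈ subsetOf Q? → Q i
∈-subsetOf⁻ Q? {i} i∈ = witness (Q? i) (trans (sym (lookup∘tabulate _ i)) ([]=⇒lookup i∈))
  where
  witness : ∀ {A : Set} (a? : Dec A) → does a? ≡ true → A
  witness (yes a) _ = a
  witness (no _)  ()

module Walks {n : ℕ} (G : Graph n) where
  open Graph G using (_~_)

  reach-start : ∀ {P a b} → Reach G P a b → P a
  reach-start (here p)     = p
  reach-start (step p _ _) = p

  reach-end : ∀ {P a b} → Reach G P a b → P b
  reach-end (here p)     = p
  reach-end (step _ _ r) = reach-end r

  reach-trans : ∀ {P a b c} → Reach G P a b → Reach G P b c → Reach G P a c
  reach-trans (here _)     r′ = r′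
  reach-trans (step p e r) r′ = step p e (reach-trans r r′)

  reach-sym : ∀ {P a b} → Reach G P a b → Reach G P b a
  reach-sym (here p)     = here p
  reach-sym (step p e r) = reach-trans (reach-sym r) (step (reach-start r) (Graph.sym G e) (here p))

  reach-mono : ∀ {P Q : Fin n → Set} {a b} → (∀ i → P i → Q i) → Reach G P a b → Reach G Q a b
  reach-mono h (here p)     = here (h _ p)
  reach-mono h (step p e r) = step (h _ p) e (reach-mono h r)

  reach-within : ∀ {P a b} (D : Subset n) → (∀ u v → u ∈ D → Reach G P u v → v ∈ D)
               → a ∈ D → Reach G P a b → Reach G (_∈ D) a b
  reach-within D closed a∈ (here _)     = here a∈
  reach-within D closed a∈ (step p e r) =
    step a∈ e (reach-within D closed (closed _ _ a∈ (step p e (here (reach-start r)))) r)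

  component-walk : ∀ {P C u v} → IsComponent G P C → u ∈ C → v ∈ C → Reach G (_∈ C) u v
  component-walk {u = u} {v} (_ , _ , connected , closed) u∈ v∈ =
    reach-within _ closed u∈ (connected u v u∈ v∈)

module Components {n : ℕ} (G : Graph n) (P : Fin n → Set)
                  (reach? : ∀ a b → Dec (Reach G P a b)) where
  open Walks G

  componentOf : Fin n → Subset n
  componentOf w = subsetOf (reach? w)

  componentOf-isComponent : ∀ {w} → P w → IsComponent G P (componentOf w)
  componentOf-isComponent {w} pw =
    (w , ∈-subsetOf⁺ (reach? w) (here pw)) ,
    (λ u u∈ → reach-end (∈-subsetOf⁻ (reach? w) u∈)) ,
    connected ,
    (λ u v u∈ r → ∈-subsetOf⁺ (reach? w) (reach-trans (∈-subsetOf⁻ (reach? w) u∈) r))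
    where
    connected : ∀ u v → u ∈ componentOf w → v ∈ componentOf w → Reach G P u v
    connected u v u∈ v∈ =
      reach-trans (reach-sym (∈-subsetOf⁻ (reach? w) u∈)) (∈-subsetOf⁻ (reach? w) v∈)

  component≡componentOf : ∀ {C c} → IsComponent G P C → c ∈ C → C ≡ componentOf c
  component≡componentOf {c = c} (_ , _ , connected , closed) c∈ =
    ⊆-antisym (λ i∈ → ∈-subsetOf⁺ (reach? c) (connected c _ c∈ i∈))
              (λ i∈ → closed c _ c∈ (∈-subsetOf⁻ (reach? c) i∈))

  MaxComponentSize : ℕ → Set
  MaxComponentSize k =
    (∀ C → IsComponent G P C → ∣ C ∣ ≤ k) ×
    ((k ≡ zero × (∀ u → ¬ P u)) ⊎ (∃[ C ] (IsComponent G P C × ∣ C ∣ ≡ k)))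

  maxComponentSize : (∀ i → Dec (P i)) → ∃[ k ] MaxComponentSize k
  maxComponentSize P? with any? P?
  ... | no ∄P = zero , empty-bound , inj₁ (refl , λ u pu → ∄P (u , pu))
    where
    empty-bound : ∀ C → IsComponent G P C → ∣ C ∣ ≤ zero
    empty-bound C ((c , c∈) , inP , _) = ⊥-elim (∄P (c , inP c c∈))
  ... | yes (w , pw) = size m , bound , inj₂ (componentOf m , componentOf-isComponent pm , refl)
    where
    size : Fin n → ℕ
    size v = ∣ componentOf v ∣
    m : Fin n
    m = argmax size w (filter P? (allFin n))
    pm : P m
    pm = argmax-all size pw (all-filter P? (allFin n))
    bound : ∀ C → IsComponent G P C → ∣ C ∣ ≤ size m
    bound C C-comp@((c , c∈) , inP , _) =
      subst (_≤ size m) (cong ∣_∣ (sym (component≡componentOf C-comp c∈)))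
            (All-lookup (f[xs]≤f[argmax] w _) (∈-filter⁺ P? (∈-allFin c) (inP c c∈)))

module ClosedNeighbourhoods {n : ℕ} (G : Graph n) where
  open Graph G using (_~_; dec)
  open Walks G

  outside? : ∀ v i → Dec (OutsideClosedNbhd G v i)
  outside? v i = ¬? ((i ≟ v) ⊎-dec dec v i)

  m-exists : ∀ v → (∀ a b → Dec (Reach G (OutsideClosedNbhd G v) a b)) → ∃[ k ] HasM G v k
  m-exists v reach? = Components.maxComponentSize G _ reach? (outside? v)

  centre-in-rest : ∀ {x C} → IsCompOf G x C → InRest G C x
  centre-in-rest (_ , inP , _) =
    (λ x∈ → inP _ x∈ (inj₁ refl)) , λ { (_ , c , c∈ , x~c) → inP c c∈ (inj₂ x~c) }

  rest-avoids : ∀ {C u} → InRest G C u → ∀ c → c ∈ C → OutsideClosedNbhd G u c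
  rest-avoids (u∉C , _)   c c∈ (inj₁ refl) = u∉C c∈
  rest-avoids (u∉C , u∉S) c c∈ (inj₂ u~c)  = u∉S (u∉C , c , c∈ , u~c)

  boundary-avoids : ∀ {C u v} → InRest G C u → InNbhdOfSet G C v → ¬ u ~ v
                  → OutsideClosedNbhd G u v
  boundary-avoids (u∉C , u∉S) (_ , c , c∈ , v~c) u≁v (inj₁ refl) = u∉S (u∉C , c , c∈ , v~c)
  boundary-avoids _           _                   u≁v (inj₂ u~v)  = u≁v u~v

  boundary-reaches : ∀ {P C u v} → IsComponent G P C → InRest G C u → InNbhdOfSet G C v
                   → ¬ u ~ v → ∀ c → c ∈ C → Reach G (OutsideClosedNbhd G u) v c
  boundary-reaches C-comp u∈X v∈S@(_ , c₀ , c₀∈ , v~c₀) u≁v c c∈ =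
    step (boundary-avoids u∈X v∈S u≁v) v~c₀
         (reach-mono (rest-avoids u∈X) (component-walk C-comp c₀∈ c∈))

  -- Hence m(u) > |C|: the component of G - N[u] through v contains C ∪ {v}.
  m-exceeds : ∀ {P C u v k} → (∀ a b → Dec (Reach G (OutsideClosedNbhd G u) a b))
            → IsComponent G P C → InRest G C u → InNbhdOfSet G C v → ¬ u ~ v
            → HasM G u k → ∣ C ∣ < k
  m-exceeds {C = C} {u = u} {v = v} reach? C-comp u∈X v∈S@(v∉C , _) u≁v (bound , _) =
    ≤-trans (p⊂q⇒∣p∣<∣q∣ (C⊆D , v , ∈-D (here v-outside) , v∉C))
            (bound D (componentOf-isComponent v-outside))
    where
    open Components G (OutsideClosedNbhd G u) reach?
    D : Subset n
    D = componentOf v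
    ∈-D : ∀ {i} → Reach G (OutsideClosedNbhd G u) v i → i ∈ D
    ∈-D = ∈-subsetOf⁺ (reach? v)
    v-outside : OutsideClosedNbhd G u v
    v-outside = boundary-avoids u∈X v∈S u≁v
    C⊆D : ∀ {c} → c ∈ C → c ∈ D
    C⊆D c∈ = ∈-D (boundary-reaches C-comp u∈X v∈S u≁v _ c∈)

open ClosedNeighbourhoods

mainTheorem3 : ∀ {n : ℕ} (G : Graph n) (x : Fin n) (C : Subset n)
    → Connected G
    → IsExtreme G x
    → IsCompOf G x C
    → (∀ C′ → IsCompOf G x C′ → ∣ C′ ∣ ≤ ∣ C ∣)
    → InRest G C x
      × (∀ u v → InRest G C u → InNbhdOfSet G C v → Graph._~_ G u v)
mainTheorem3 G x C _ (k , m[x]≡k , extreme) C-comp C-max =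
  centre-in-rest G C-comp , adjacent
  where
  k≤∣C∣ : k ≤ ∣ C ∣
  k≤∣C∣ with proj₂ m[x]≡k
  ... | inj₁ (refl , _)            = z≤n
  ... | inj₂ (C′ , C′-comp , refl) = C-max C′ C′-comp

  adjacent : ∀ u v → InRest G C u → InNbhdOfSet G C v → Graph._~_ G u v
  adjacent u v u∈X v∈S = decidable-stable (Graph.dec G u v) λ u≁v →
    ¬¬-decidable₂ _ λ reach? →
      let (k′ , m[u]≡k′) = m-exists G u reach? in
      <⇒≱ (m-exceeds G reach? C-comp u∈X v∈S u≁v m[u]≡k′)
          (≤-trans (extreme u k′ m[u]≡k′) k≤∣C∣)
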